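{- Let $T$ be an arborescence and let $\mathcal{P}$ be the set of (nonempty) directed paths of $T$, each identified with its arc set. Then the poset $(\mathcal{P},\subseteq)$ has order dimension at most 3.
   Context: An arborescence is a directed tree with a root such that every other node is reachable from the root by a directed path. The (order) dimension of a finite poset is the minimum number of linear extensions whose intersection is the order. -}

module Defs where

open import Data.Nat using (ℕ; _≤_)
open import Data.Fin using (Fin)
open import Data.List using (List; []; _∷_; length)
open import Data.List.Relation.Unary.Linked using (Linked)
open import Data.List.Relation.Unary.Unique.Propositional using (Unique)
open import Data.Product using (Σ; ∃; _×_)
open import Data.Sum using (_⊎_)
open import Relation.Nullary using (¬_)
open import Relation.Binary.Construct.Closure.ReflexiveTransitive using (Star)
open import Relation.Binary.Structures using (IsTotalOrder)

Digraph : ℕ → Set₁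
Digraph n = Fin n → Fin n → Set

module _ {n : ℕ} (Arc : Digraph n) where

  Adj : Fin n → Fin n → Set
  Adj u v = Arc u v ⊎ Arc v u

  last′ : Fin n → List (Fin n) → Fin n
  last′ x []       = x
  last′ x (y ∷ ys) = last′ y ys

  UCycle : Set
  UCycle = Σ (Fin n) λ x → Σ (List (Fin n)) λ vs →
             (2 ≤ length vs) × Unique (x ∷ vs) × Linked Adj (x ∷ vs)
             × Adj (last′ x vs) x

  -- the underlying undirected multigraph has no cycles:
  -- no loops, no pair of antiparallel arcs (a 2-cycle), no longer cycle
  UnderlyingAcyclic : Set
  UnderlyingAcyclic = (∀ v → ¬ Arc v v)
                    × (∀ u v → Arc u v → ¬ Arc v u)
                    × ¬ UCycle

  -- Arborescence: a directed tree (underlying graph is a tree) with a root r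
  -- from which every vertex is reachable by a directed path.
  -- (Connectedness of the underlying graph follows from reachability.)
  IsArborescence : Set
  IsArborescence = UnderlyingAcyclic × ∃ λ (r : Fin n) → ∀ v → Star Arc r v

  record DPath : Set where
    constructor dpath
    field
      verts   : List (Fin n)
      nonempt : 2 ≤ length verts
      distinct : Unique verts
      arcs    : Linked Arc verts

  data _⟶_∈_ (a b : Fin n) : List (Fin n) → Set where
    here  : ∀ {xs} → a ⟶ b ∈ (a ∷ b ∷ xs)
    there : ∀ {x xs} → a ⟶ b ∈ xs → a ⟶ b ∈ (x ∷ xs)

  _⊆ₚ_ : DPath → DPath → Set
  P ⊆ₚ Q = ∀ a b → a ⟶ b ∈ DPath.verts P → a ⟶ b ∈ DPath.verts Q

  -- equality of arc sets (paths are identified with their arc sets)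
  _≈ₚ_ : DPath → DPath → Set
  P ≈ₚ Q = P ⊆ₚ Q × Q ⊆ₚ P

  -- the poset (𝒫, ⊆) has order dimension at most k: there are k linear orders
  -- on 𝒫 (total orders w.r.t. arc-set equality) whose intersection is ⊆
  DimensionAtMost : ℕ → Set₁
  DimensionAtMost k =
    Σ (Fin k → DPath → DPath → Set) λ L →
      (∀ i → IsTotalOrder _≈ₚ_ (L i))
      × (∀ P Q → (P ⊆ₚ Q → ∀ i → L i P Q) × ((∀ i → L i P Q) → P ⊆ₚ Q))

module Submission where

-- Let r be the root.  Every vertex v is reached from r by exactly one directed
-- walk; call the list of its vertices after r the spine of v.  Uniqueness holds
-- because no arc enters r and every vertex has at most one in-arc; the latter
-- holds because two in-arcs x → v, y → v would give two different simple
-- undirected r–v paths, while simple paths in a graph without undirected cycles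
-- are unique.  A directed path u ∷ t ending in w satisfies
-- spine w = spine u ++ t, hence it is determined by the pair
-- (lo, hi) = (spine u, spine w), and P ⊆ Q iff lo Q ≼ lo P and hi P ≼ hi Q,
-- where ≼ is the prefix order.
--
-- Let ≤₊ / ≤₋ be the lexicographic orders on vertex lists induced by the order
-- of Fin n and by its reverse; xs ≤₊ ys and xs ≤₋ ys together force xs ≼ ys.
-- The three linear orders compare the keys lexicographically:
--   (hi by ≤₊, then lo by ≥₊),  (hi by ≤₋, then lo by ≥₊),  (lo by ≥₊, then hi by ≤₊).
-- All three contain ⊆.  Conversely the first two give hi P ≼ hi Q; the third
-- gives lo Q ≤₊ lo P, and since lo P and lo Q are both prefixes of hi Q they are
-- ≼-comparable, so lo Q ≼ lo P.

open import Data.Nat using (ℕ; _≤_; s≤s; z≤n)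
open import Data.Nat.Properties using (m≤n+m)
open import Data.Fin as Fin using (Fin)
open import Data.Fin.Properties as FinP using ()
open import Data.List using (List; []; _∷_; length; _++_)
open import Data.List.Properties
  using (++-assoc; ++-identityʳ; ++-identityʳ-unique; ++-conicalˡ; ++-cancelˡ; ∷-injective; ∷ʳ-injectiveˡ; length-++)
open import Data.List.Relation.Unary.Linked as Linked using (Linked; []; [-]; _∷_)
open import Data.List.Relation.Unary.AllPairs as AllPairs using ([]; _∷_)
open import Data.List.Relation.Unary.All using ([]; _∷_)
open import Data.List.Relation.Unary.All.Properties using (¬Any⇒All¬; ++⁻ˡ)
open import Data.List.Relation.Unary.Any using (here; there)
open import Data.List.Relation.Unary.Unique.Propositional using (Unique)
open import Data.List.Relation.Unary.Unique.Propositional.Properties using (Unique[x∷xs]⇒x∉xs)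
import Data.List.Relation.Unary.Unique.Propositional.Properties as UniqueP
open import Data.List.Membership.Propositional using (_∈_; _∉_)
open import Data.List.Membership.Propositional.Properties using (∈-∃++)
import Data.List.Membership.DecPropositional as DecMembership
open import Data.List.Relation.Binary.Lex.Strict as LexS using (Lex-≤; base; halt; this; next)
open import Data.List.Relation.Binary.Pointwise using (Pointwise; Pointwise-≡⇒≡; ≡⇒Pointwise-≡)
import Data.List.Relation.Binary.Pointwise.Properties as PointwiseP
import Data.Product.Relation.Binary.Lex.NonStrict as ProductLex
open import Data.Product using (Σ; _×_; _,_; proj₂; swap)
open import Data.Sum as Sum using (_⊎_; inj₁; inj₂)
open import Data.Empty using (⊥; ⊥-elim)
open import Data.Unit using (tt)
open import Function using (flip)
open import Relation.Nullary using (¬_; yes; no)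
open import Relation.Binary.Definitions using (Decidable; Irreflexive; Asymmetric)
open import Relation.Binary.Structures using (IsTotalOrder; IsEquivalence)
import Relation.Binary.Construct.Flip.EqAndOrd as Flip
open import Relation.Binary.Construct.Closure.ReflexiveTransitive using (Star; ε; _◅_)
open import Relation.Binary.PropositionalEquality
open import Defs

module Lists {A : Set} where

  _≼_ : List A → List A → Set
  xs ≼ ys = Σ (List A) λ m → ys ≡ xs ++ m

  ≼-refl : ∀ xs → xs ≼ xs
  ≼-refl xs = [] , sym (++-identityʳ xs)

  ≼-reflexive : ∀ {xs ys} → xs ≡ ys → xs ≼ ys
  ≼-reflexive {xs} refl = ≼-refl xs

  ≼-trans : ∀ {xs ys zs} → xs ≼ ys → ys ≼ zs → xs ≼ zs
  ≼-trans {xs} (m , ys≡) (m′ , zs≡) = m ++ m′ , trans zs≡ (trans (cong (_++ m′) ys≡) (++-assoc xs m m′))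

  ≼-antisym : ∀ {xs ys} → xs ≼ ys → ys ≼ xs → xs ≡ ys
  ≼-antisym {xs} {ys} (m , ys≡xs++m) (m′ , xs≡ys++m′) = begin
      xs      ≡⟨ sym (++-identityʳ xs) ⟩
      xs ++ [] ≡⟨ cong (xs ++_) (sym m≡[]) ⟩
      xs ++ m ≡⟨ sym ys≡xs++m ⟩
      ys      ∎
    where
      open ≡-Reasoning
      m≡[] : m ≡ []
      m≡[] = ++-conicalˡ m m′ (++-identityʳ-unique xs (begin
        xs              ≡⟨ xs≡ys++m′ ⟩
        ys ++ m′        ≡⟨ cong (_++ m′) ys≡xs++m ⟩
        (xs ++ m) ++ m′ ≡⟨ ++-assoc xs m m′ ⟩
        xs ++ (m ++ m′) ∎))

  ∷-≼ : ∀ x {xs ys} → xs ≼ ys → (x ∷ xs) ≼ (x ∷ ys)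
  ∷-≼ x (m , ys≡) = m , cong (x ∷_) ys≡

  ≼-common : ∀ xs ys {zs} → xs ≼ zs → ys ≼ zs → xs ≼ ys ⊎ ys ≼ xs
  ≼-common []       ys       _ _ = inj₁ (ys , refl)
  ≼-common (x ∷ xs) []       _ _ = inj₂ (x ∷ xs , refl)
  ≼-common (x ∷ xs) (y ∷ ys) {[]} (_ , ()) _
  ≼-common (x ∷ xs) (y ∷ ys) {z ∷ zs} (m , e) (m′ , e′)
    with ∷-injective e | ∷-injective e′
  ... | refl , zs≡ | refl , zs≡′ = Sum.map (∷-≼ x) (∷-≼ x) (≼-common xs ys (m , zs≡) (m′ , zs≡′))

  Unique-++⁻ˡ : ∀ xs {ys : List A} → Unique (xs ++ ys) → Unique xs
  Unique-++⁻ˡ []       _          = []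
  Unique-++⁻ˡ (x ∷ xs) (x∉ ∷ u) = ++⁻ˡ xs x∉ ∷ Unique-++⁻ˡ xs u

  Unique-++⁻ʳ : ∀ xs {ys : List A} → Unique (xs ++ ys) → Unique ys
  Unique-++⁻ʳ []       u       = u
  Unique-++⁻ʳ (x ∷ xs) (_ ∷ u) = Unique-++⁻ʳ xs u

  Linked-++⁻ˡ : ∀ {R : A → A → Set} xs {ys} → Linked R (xs ++ ys) → Linked R xs
  Linked-++⁻ˡ []           _       = []
  Linked-++⁻ˡ (x ∷ [])     _       = [-]
  Linked-++⁻ˡ (x ∷ y ∷ xs) (e ∷ l) = e ∷ Linked-++⁻ˡ (y ∷ xs) l

  Linked-++⁻ʳ : ∀ {R : A → A → Set} xs {ys} → Linked R (xs ++ ys) → Linked R ys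
  Linked-++⁻ʳ []       l = l
  Linked-++⁻ʳ (x ∷ xs) l = Linked-++⁻ʳ xs (Linked.tail l)

open Lists

module LastVertex {n : ℕ} (Arc : Digraph n) where

  lst : Fin n → List (Fin n) → Fin n
  lst = last′ Arc

  last-++ : ∀ x xs ys → lst x (xs ++ ys) ≡ lst (lst x xs) ys
  last-++ x []       ys = refl
  last-++ x (y ∷ xs) ys = last-++ y xs ys

  last-∈ : ∀ x xs → lst x xs ∈ x ∷ xs
  last-∈ x []       = here refl
  last-∈ x (y ∷ xs) = there (last-∈ y xs)

  last-suffix : ∀ {x xs} ys a zs → x ∷ xs ≡ ys ++ a ∷ zs → lst x xs ≡ lst a zs
  last-suffix []       a zs refl = refl
  last-suffix (y ∷ ys) a zs refl = last-++ y ys (a ∷ zs)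

  Linked-snoc : ∀ {R : Fin n → Fin n → Set} {x xs v} →
                Linked R (x ∷ xs) → R (lst x xs) v → Linked R (x ∷ xs ++ v ∷ [])
  Linked-snoc {xs = []}     _        e = e ∷ [-]
  Linked-snoc {xs = y ∷ ys} (e′ ∷ l) e = e′ ∷ Linked-snoc l e

module Forest {n : ℕ} (Arc : Digraph n) (noCycle : ¬ UCycle Arc) where

  open LastVertex Arc
  open DecMembership (FinP._≟_ {n}) using (_∈?_)

  Adj-sym : ∀ {x y} → Adj Arc x y → Adj Arc y x
  Adj-sym (inj₁ e) = inj₂ e
  Adj-sym (inj₂ e) = inj₁ e

  -- a simple path c ∷ q ∷ A ++ p ∷ B cannot have p adjacent to c again:
  -- c ∷ q ∷ A ++ [p] would be a cycle of length ≥ 3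
  no-chord-back : ∀ c q A p B → Unique (c ∷ q ∷ A ++ p ∷ B) →
                  Linked (Adj Arc) (c ∷ q ∷ A ++ p ∷ B) → ¬ Adj Arc p c
  no-chord-back c q A p B u l p~c =
    noCycle (c , q ∷ A ++ p ∷ [] , long , Unique-++⁻ˡ cyc (subst Unique split u)
            , Linked-++⁻ˡ cyc (subst (Linked (Adj Arc)) split l)
            , subst (λ z → Adj Arc z c) (sym (last-++ q A (p ∷ []))) p~c)
    where
      cyc : List (Fin n)
      cyc = c ∷ q ∷ A ++ p ∷ []
      split : c ∷ q ∷ A ++ p ∷ B ≡ cyc ++ B
      split = cong (λ z → c ∷ q ∷ z) (sym (++-assoc A (p ∷ []) B))
      long : 2 ≤ length (q ∷ A ++ p ∷ [])
      long = s≤s (subst (1 ≤_) (sym (length-++ A)) (m≤n+m 1 (length A)))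

  branches-disjoint : ∀ c p P q Q → Unique (c ∷ p ∷ P) → Unique (c ∷ q ∷ Q) →
                      Linked (Adj Arc) (c ∷ p ∷ P) → Linked (Adj Arc) (c ∷ q ∷ Q) →
                      p ≢ q → lst p P ∉ q ∷ Q
  branches-disjoint c p P q Q uP uQ lP lQ p≢q end∈ with p ∈? q ∷ Q
  ... | yes p∈ with ∈-∃++ p∈
  ...   | [] , B , refl = p≢q refl
  ...   | (.q ∷ A) , B , refl = no-chord-back c q A p B uQ lQ (Adj-sym (Linked.head lP))
  branches-disjoint c p [] q Q uP uQ lP lQ p≢q end∈ | no p∉ = p∉ end∈
  branches-disjoint c p (p′ ∷ P) q Q ((c≢p ∷ c≢p′ ∷ _) ∷ uP) uQ (c~p ∷ lP) lQ p≢q end∈ | no p∉ =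
    branches-disjoint p p′ P c (q ∷ Q) uP uQ′ lP (Adj-sym c~p ∷ lQ) (≢-sym c≢p′) (there end∈)
    where
      uQ′ : Unique (p ∷ c ∷ q ∷ Q)
      uQ′ = ((≢-sym c≢p) ∷ ¬Any⇒All¬ _ p∉) ∷ uQ

  path-unique : ∀ a P Q → Unique (a ∷ P) → Unique (a ∷ Q) →
                Linked (Adj Arc) (a ∷ P) → Linked (Adj Arc) (a ∷ Q) → lst a P ≡ lst a Q → P ≡ Q
  path-unique a []      []      _  _  _  _  _  = refl
  path-unique a []      (q ∷ Q) _  uQ _  _  eq = ⊥-elim (Unique[x∷xs]⇒x∉xs uQ (subst (_∈ q ∷ Q) (sym eq) (last-∈ q Q)))
  path-unique a (p ∷ P) []      uP _  _  _  eq = ⊥-elim (Unique[x∷xs]⇒x∉xs uP (subst (_∈ p ∷ P) eq (last-∈ p P)))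
  path-unique a (p ∷ P) (q ∷ Q) uP uQ lP lQ eq with p FinP.≟ q
  ... | yes refl = cong (p ∷_) (path-unique p P Q (AllPairs.tail uP) (AllPairs.tail uQ) (Linked.tail lP) (Linked.tail lQ) eq)
  ... | no p≢q   = ⊥-elim (branches-disjoint a p P q Q uP uQ lP lQ p≢q (subst (_∈ q ∷ Q) (sym eq) (last-∈ q Q)))

module PathArcs {n : ℕ} (Arc : Digraph n) where

  open LastVertex Arc

  ArcOf : Fin n → Fin n → List (Fin n) → Set
  ArcOf a b xs = _⟶_∈_ Arc a b xs

  ArcOf-source : ∀ {a b xs} → ArcOf a b xs → a ∈ xs
  ArcOf-source here      = here refl
  ArcOf-source (there α) = there (ArcOf-source α)

  ArcOf-target : ∀ {a b xs} → ArcOf a b xs → b ∈ xs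
  ArcOf-target here      = there (here refl)
  ArcOf-target (there α) = there (ArcOf-target α)

  last-arc : ∀ u w t → Σ (Fin n) λ a → ArcOf a (lst u (w ∷ t)) (u ∷ w ∷ t)
  last-arc u w []      = u , here
  last-arc u w (x ∷ t) with last-arc w x t
  ... | a , α = a , there α

  ArcOf-segment : ∀ {a b u t} u′ m s → lst u′ m ≡ u → ArcOf a b (u ∷ t) → ArcOf a b (u′ ∷ m ++ (t ++ s))
  ArcOf-segment u′ []      s refl α = ++⁺ α
    where
      ++⁺ : ∀ {a b xs} → ArcOf a b xs → ArcOf a b (xs ++ s)
      ++⁺ here      = here
      ++⁺ (there α) = there (++⁺ α)
  ArcOf-segment u′ (x ∷ m) s eq   α = there (ArcOf-segment x m s eq α)

  ≈ₚ-isEquivalence : IsEquivalence (_≈ₚ_ Arc)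
  ≈ₚ-isEquivalence = record
    { refl  = (λ _ _ α → α) , (λ _ _ α → α)
    ; sym   = λ (P⊆Q , Q⊆P) → Q⊆P , P⊆Q
    ; trans = λ (P⊆Q , Q⊆P) (Q⊆R , R⊆Q) → (λ a b α → Q⊆R a b (P⊆Q a b α)) , (λ a b α → Q⊆P a b (R⊆Q a b α))
    }

module LexicographicPrefix {A : Set} (_<_ : A → A → Set) where

  _≤ˡᵉˣ_ : List A → List A → Set
  _≤ˡᵉˣ_ = Lex-≤ _≡_ _<_

  ≼⇒lex : ∀ {xs ys} → xs ≼ ys → xs ≤ˡᵉˣ ys
  ≼⇒lex {xs} (m , refl) = prefix xs m
    where
      prefix : ∀ xs m → xs ≤ˡᵉˣ (xs ++ m)
      prefix []       []      = base tt
      prefix []       (_ ∷ _) = halt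
      prefix (x ∷ xs) m       = next refl (prefix xs m)

  module _ (irrefl : Irreflexive _≡_ _<_) (asym : Asymmetric _<_) where

    lex-both⇒≼ : ∀ {xs ys} → xs ≤ˡᵉˣ ys → Lex-≤ _≡_ (flip _<_) xs ys → xs ≼ ys
    lex-both⇒≼ (base _)      (base _)      = [] , refl
    lex-both⇒≼ halt          halt          = _ , refl
    lex-both⇒≼ (this x<y)    (this y<x)    = ⊥-elim (asym x<y y<x)
    lex-both⇒≼ (this x<y)    (next x≡y _)  = ⊥-elim (irrefl x≡y x<y)
    lex-both⇒≼ (next x≡y _)  (this y<x)    = ⊥-elim (irrefl (sym x≡y) y<x)
    lex-both⇒≼ (next refl l) (next refl l′) = ∷-≼ _ (lex-both⇒≼ l l′)

    lex-common⇒≼ : ∀ {xs ys zs} → xs ≼ zs → ys ≼ zs → ys ≤ˡᵉˣ xs → ys ≼ xs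
    lex-common⇒≼ {xs} {ys} xs≼zs ys≼zs ys≤xs with ≼-common xs ys xs≼zs ys≼zs
    ... | inj₂ ys≼xs = ys≼xs
    ... | inj₁ xs≼ys = ≼-reflexive (Pointwise-≡⇒≡ (LexS.≤-antisymmetric sym irrefl asym ys≤xs (≼⇒lex xs≼ys)))

module LexicographicProduct {X Y : Set} (_≈_ _≤₁_ : X → X → Set) (_≤₂_ : Y → Y → Set) where

  open ProductLex using (×-Lex)

  ×-Lex-fst : (∀ {a b} → a ≈ b → a ≤₁ b) → ∀ {a₁ a₂ b₁ b₂} →
              ×-Lex _≈_ _≤₁_ _≤₂_ (a₁ , a₂) (b₁ , b₂) → a₁ ≤₁ b₁
  ×-Lex-fst _    (inj₁ (a≤b , _)) = a≤b
  ×-Lex-fst ≈⇒≤ (inj₂ (a≈b , _)) = ≈⇒≤ a≈b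

  ×-Lex-intro : Decidable _≈_ → ∀ {a₁ a₂ b₁ b₂} → a₁ ≤₁ b₁ → (a₁ ≈ b₁ → a₂ ≤₂ b₂) →
                ×-Lex _≈_ _≤₁_ _≤₂_ (a₁ , a₂) (b₁ , b₂)
  ×-Lex-intro _≟_ {a₁} {b₁ = b₁} a≤b second with a₁ ≟ b₁
  ... | yes a≈b = inj₂ (a≈b , second a≈b)
  ... | no  a≉b = inj₁ (a≤b , a≉b)

pullback-total : ∀ {A X : Set} {_≈_ : A → A → Set} {_≈X_ _≤X_ : X → X → Set} →
                 IsEquivalence _≈_ → IsTotalOrder _≈X_ _≤X_ → (f : A → X) →
                 (∀ {a b} → a ≈ b → f a ≈X f b) → (∀ {a b} → f a ≈X f b → a ≈ b) →
                 IsTotalOrder _≈_ (λ a b → f a ≤X f b)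
pullback-total isEq total f preserve reflect = record
  { isPartialOrder = record
    { isPreorder = record
      { isEquivalence = isEq
      ; reflexive     = λ a≈b → X.reflexive (preserve a≈b)
      ; trans         = X.trans
      }
    ; antisym = λ a≤b b≤a → reflect (X.antisym a≤b b≤a)
    }
  ; total = λ a b → X.total (f a) (f b)
  }
  where module X = IsTotalOrder total

module Arborescence {n : ℕ} (Arc : Digraph n)
  (noLoop : ∀ v → ¬ Arc v v) (noDigon : ∀ u v → Arc u v → ¬ Arc v u)
  (noCycle : ¬ UCycle Arc) (r : Fin n) (reach : ∀ v → Star Arc r v) where

  open LastVertex Arc
  open PathArcs Arc
  open Forest Arc noCycle using (path-unique)
  open DecMembership (FinP._≟_ {n}) using (_∈?_)

  V : Set
  V = Fin n

  record SimplePath (a b : V) : Set where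
    constructor simplePath
    field
      rest   : List V
      unique : Unique (a ∷ rest)
      linked : Linked Arc (a ∷ rest)
      ends   : lst a rest ≡ b
  open SimplePath

  SimplePath-from : ∀ {x a b} (p : SimplePath x b) → a ∈ x ∷ rest p → SimplePath a b
  SimplePath-from (simplePath vs u l e) a∈ with ∈-∃++ a∈
  ... | A , B , split =
    simplePath B (Unique-++⁻ʳ A (subst Unique split u)) (Linked-++⁻ʳ A (subst (Linked Arc) split l))
               (trans (sym (last-suffix A _ B split)) e)

  SimplePath-cons : ∀ {a y b} → Arc a y → SimplePath y b → SimplePath a b
  SimplePath-cons {a} a→y p with a ∈? (_ ∷ rest p)
  ... | yes a∈ = SimplePath-from p a∈
  ... | no a∉  = simplePath (_ ∷ rest p) (¬Any⇒All¬ _ a∉ ∷ unique p) (a→y ∷ linked p) (ends p)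

  simplify : ∀ {a b} → Star Arc a b → SimplePath a b
  simplify ε            = simplePath [] ([] ∷ []) [-] refl
  simplify (a→y ◅ walk) = SimplePath-cons a→y (simplify walk)

  no-return : ∀ {a b} → SimplePath a b → ¬ Arc b a
  no-return (simplePath []           _ _           refl) e = noLoop _ e
  no-return (simplePath (b ∷ [])     _ (a→b ∷ _)   refl) e = noDigon _ _ a→b e
  no-return {a} (simplePath (b ∷ c ∷ ws) u l       refl) e =
    noCycle (a , b ∷ c ∷ ws , s≤s (s≤s z≤n) , u , Linked.map inj₁ l , inj₁ e)

  root-no-in-arc : ∀ {x} → ¬ Arc x r
  root-no-in-arc {x} = no-return (simplify (reach x))

  SimplePath-snoc : ∀ {a x v} (p : SimplePath a x) → Arc x v → SimplePath a v
  SimplePath-snoc {a} {x} {v} p x→v = simplePath (rest p ++ v ∷ [])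
    (UniqueP.++⁺ (unique p) ([] ∷ []) fresh)
    (Linked-snoc (linked p) (subst (λ z → Arc z v) (sym (ends p)) x→v))
    (last-++ a (rest p) (v ∷ []))
    where
      -- v is not on p, or p would close a directed cycle through x → v
      fresh : ∀ {w} → w ∈ a ∷ rest p × w ∈ v ∷ [] → ⊥
      fresh (v∈ , here refl) = no-return (SimplePath-from p v∈) x→v

  SimplePath-unique : ∀ {a b} (p q : SimplePath a b) → rest p ≡ rest q
  SimplePath-unique {a} p q = path-unique a (rest p) (rest q) (unique p) (unique q)
    (Linked.map inj₁ (linked p)) (Linked.map inj₁ (linked q)) (trans (ends p) (sym (ends q)))

  in-arc-unique : ∀ {x y v} → Arc x v → Arc y v → x ≡ y
  in-arc-unique {x} {y} x→v y→v = begin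
      x                ≡⟨ sym (ends px) ⟩
      lst r (rest px)  ≡⟨ cong (lst r) same-rest ⟩
      lst r (rest py)  ≡⟨ ends py ⟩
      y                ∎
    where
      open ≡-Reasoning
      px : SimplePath r x
      px = simplify (reach x)
      py : SimplePath r y
      py = simplify (reach y)
      same-rest : rest px ≡ rest py
      same-rest = ∷ʳ-injectiveˡ (rest px) (rest py)
        (SimplePath-unique (SimplePath-snoc px x→v) (SimplePath-snoc py y→v))

  data RootWalk : V → List V → Set where
    root : RootWalk r []
    step : ∀ {y z l} → RootWalk y l → Arc y z → RootWalk z (l ++ z ∷ [])

  RootWalk-unique : ∀ {v l l′} → RootWalk v l → RootWalk v l′ → l ≡ l′
  RootWalk-unique root       root         = refl
  RootWalk-unique root       (step _ e)   = ⊥-elim (root-no-in-arc e)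
  RootWalk-unique (step _ e) root         = ⊥-elim (root-no-in-arc e)
  RootWalk-unique (step w e) (step w′ e′) with in-arc-unique e e′
  ... | refl = cong (_++ _) (RootWalk-unique w w′)

  RootWalk-extend : ∀ {u l} t → RootWalk u l → Linked Arc (u ∷ t) → RootWalk (lst u t) (l ++ t)
  RootWalk-extend {u} {l} []      w _       = subst (RootWalk u) (sym (++-identityʳ l)) w
  RootWalk-extend {u} {l} (y ∷ t) w (e ∷ p) =
    subst (RootWalk (lst y t)) (++-assoc l (y ∷ []) t) (RootWalk-extend t (step w e) p)

  spine : V → List V
  spine v = rest (simplify (reach v))

  spine-ends : ∀ v → lst r (spine v) ≡ v
  spine-ends v = ends (simplify (reach v))

  spine-walk : ∀ v → RootWalk v (spine v)
  spine-walk v = subst (λ z → RootWalk z (spine v)) (spine-ends v)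
                       (RootWalk-extend (spine v) root (linked (simplify (reach v))))

  spine-path : ∀ {u t} → Linked Arc (u ∷ t) → spine (lst u t) ≡ spine u ++ t
  spine-path {u} {t} p = RootWalk-unique (spine-walk (lst u t)) (RootWalk-extend t (spine-walk u) p)

  spine-≼-on-path : ∀ {u t x} → Linked Arc (u ∷ t) → x ∈ u ∷ t → spine u ≼ spine x
  spine-≼-on-path _       (here refl) = ≼-refl _
  spine-≼-on-path (e ∷ p) (there x∈)  = ≼-trans (_ ∷ [] , spine-path (e ∷ [-])) (spine-≼-on-path p x∈)

  spine-≼-end-of-path : ∀ {u t x} → Linked Arc (u ∷ t) → x ∈ u ∷ t → spine x ≼ spine (lst u t)
  spine-≼-end-of-path {t = t} p       (here refl) = t , spine-path p
  spine-≼-end-of-path         (_ ∷ p) (there x∈)  = spine-≼-end-of-path p x∈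

  Path : Set
  Path = DPath Arc

  start : Path → V
  start (dpath []      () _ _)
  start (dpath (u ∷ _) _  _ _) = u

  path-tail : Path → List V
  path-tail (dpath []      () _ _)
  path-tail (dpath (_ ∷ t) _  _ _) = t

  end : Path → V
  end P = lst (start P) (path-tail P)

  lo hi : Path → List V
  lo P = spine (start P)
  hi P = spine (end P)

  hi-lo : ∀ P → hi P ≡ lo P ++ path-tail P
  hi-lo (dpath []      () _ _)
  hi-lo (dpath (_ ∷ _) _  _ p) = spine-path p

  -- if P ⊆ Q then P starts and ends on Q, so its spines nest inside those of Q
  ⊆⇒spines : ∀ P Q → _⊆ₚ_ Arc P Q → lo Q ≼ lo P × hi P ≼ hi Q
  ⊆⇒spines (dpath []          ()        _ _) _ _
  ⊆⇒spines (dpath (_ ∷ [])    (s≤s ())  _ _) _ _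
  ⊆⇒spines (dpath (_ ∷ _ ∷ _) _         _ _) (dpath [] () _ _) _
  ⊆⇒spines (dpath (u ∷ w ∷ t) _ _ _) (dpath (_ ∷ _) _ _ q) P⊆Q =
      spine-≼-on-path q (ArcOf-source (P⊆Q u w here))
    , spine-≼-end-of-path q (ArcOf-target (P⊆Q _ _ (proj₂ (last-arc u w t))))

  -- conversely nested spines place P as a segment of Q
  spines⇒⊆ : ∀ P Q → lo Q ≼ lo P → hi P ≼ hi Q → _⊆ₚ_ Arc P Q
  spines⇒⊆ (dpath [] () _ _) _ _ _
  spines⇒⊆ _ (dpath [] () _ _) _ _
  spines⇒⊆ P@(dpath (u ∷ t) _ _ _) Q@(dpath (u′ ∷ t′) _ _ _) (m , lo≡) (s , hi≡) a b α =
    subst (λ z → ArcOf a b (u′ ∷ z)) (sym t′≡) (ArcOf-segment u′ m s u≡ α)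
    where
      open ≡-Reasoning
      t′≡ : t′ ≡ m ++ (t ++ s)
      t′≡ = ++-cancelˡ (spine u′) t′ (m ++ (t ++ s)) (begin
        spine u′ ++ t′               ≡⟨ sym (hi-lo Q) ⟩
        hi Q                         ≡⟨ hi≡ ⟩
        hi P ++ s                    ≡⟨ cong (_++ s) (hi-lo P) ⟩
        (spine u ++ t) ++ s          ≡⟨ cong (λ z → (z ++ t) ++ s) lo≡ ⟩
        ((spine u′ ++ m) ++ t) ++ s  ≡⟨ ++-assoc (spine u′ ++ m) t s ⟩
        (spine u′ ++ m) ++ (t ++ s)  ≡⟨ ++-assoc (spine u′) m (t ++ s) ⟩
        spine u′ ++ (m ++ (t ++ s))  ∎)
      u≡ : lst u′ m ≡ u
      u≡ = begin
        lst u′ m                  ≡⟨ cong (λ z → lst z m) (sym (spine-ends u′)) ⟩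
        lst (lst r (spine u′)) m  ≡⟨ sym (last-++ r (spine u′) m) ⟩
        lst r (spine u′ ++ m)     ≡⟨ cong (lst r) (sym lo≡) ⟩
        lst r (spine u)           ≡⟨ spine-ends u ⟩
        u                         ∎

  ≈⇒spines : ∀ P Q → _≈ₚ_ Arc P Q → lo P ≡ lo Q × hi P ≡ hi Q
  ≈⇒spines P Q (P⊆Q , Q⊆P) with ⊆⇒spines P Q P⊆Q | ⊆⇒spines Q P Q⊆P
  ... | loQ≼loP , hiP≼hiQ | loP≼loQ , hiQ≼hiP = ≼-antisym loP≼loQ loQ≼loP , ≼-antisym hiP≼hiQ hiQ≼hiP

  spines⇒≈ : ∀ P Q → lo P ≡ lo Q → hi P ≡ hi Q → _≈ₚ_ Arc P Q
  spines⇒≈ P Q lo≡ hi≡ = spines⇒⊆ P Q (≼-reflexive (sym lo≡)) (≼-reflexive hi≡)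
                       , spines⇒⊆ Q P (≼-reflexive lo≡) (≼-reflexive (sym hi≡))

  ≈⇒spines′ : ∀ P Q → _≈ₚ_ Arc P Q → hi P ≡ hi Q × lo P ≡ lo Q
  ≈⇒spines′ P Q P≈Q = swap (≈⇒spines P Q P≈Q)

  spines⇒≈′ : ∀ P Q → hi P ≡ hi Q → lo P ≡ lo Q → _≈ₚ_ Arc P Q
  spines⇒≈′ P Q hi≡ lo≡ = spines⇒≈ P Q lo≡ hi≡

  _≋_ : List V → List V → Set
  _≋_ = Pointwise _≡_

  dec≋ : Decidable _≋_
  dec≋ = PointwiseP.decidable FinP._≟_

  _≤₊_ _≥₊_ _≤₋_ : List V → List V → Set
  _≤₊_ = Lex-≤ _≡_ Fin._<_
  _≥₊_ = flip _≤₊_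
  _≤₋_ = Lex-≤ _≡_ (flip Fin._<_)

  ≤₊-total : IsTotalOrder _≋_ _≤₊_
  ≤₊-total = LexS.≤-isTotalOrder FinP.<-isStrictTotalOrder

  ≥₊-total : IsTotalOrder _≋_ _≥₊_
  ≥₊-total = Flip.isTotalOrder ≤₊-total

  ≤₋-total : IsTotalOrder _≋_ _≤₋_
  ≤₋-total = LexS.≤-isTotalOrder (Flip.isStrictTotalOrder FinP.<-isStrictTotalOrder)

  open LexicographicPrefix (Fin._<_ {n}) using (lex-both⇒≼; lex-common⇒≼)
  open LexicographicPrefix using (≼⇒lex)
  open LexicographicProduct using (×-Lex-fst; ×-Lex-intro)

  byKeys : (List V → List V → Set) → (List V → List V → Set) →
           (Path → List V) → (Path → List V) → Path → Path → Set
  byKeys _≤₁_ _≤₂_ f g P Q = ProductLex.×-Lex _≋_ _≤₁_ _≤₂_ (f P , g P) (f Q , g Q)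

  byKeys-total : ∀ {_≤₁_ _≤₂_} → IsTotalOrder _≋_ _≤₁_ → IsTotalOrder _≋_ _≤₂_ →
                 (f g : Path → List V) →
                 (∀ P Q → _≈ₚ_ Arc P Q → f P ≡ f Q × g P ≡ g Q) →
                 (∀ P Q → f P ≡ f Q → g P ≡ g Q → _≈ₚ_ Arc P Q) →
                 IsTotalOrder (_≈ₚ_ Arc) (byKeys _≤₁_ _≤₂_ f g)
  byKeys-total total₁ total₂ f g determined determines =
    pullback-total ≈ₚ-isEquivalence
      (ProductLex.×-isTotalOrder dec≋ total₁ total₂)
      (λ P → f P , g P)
      (λ {P} {Q} P≈Q → let f≡ , g≡ = determined P Q P≈Q in ≡⇒Pointwise-≡ f≡ , ≡⇒Pointwise-≡ g≡)
      (λ {P} {Q} (f≋ , g≋) → determines P Q (Pointwise-≡⇒≡ f≋) (Pointwise-≡⇒≡ g≋))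

  extension : Fin 3 → Path → Path → Set
  extension Fin.zero                  = byKeys _≤₊_ _≥₊_ hi lo
  extension (Fin.suc Fin.zero)        = byKeys _≤₋_ _≥₊_ hi lo
  extension (Fin.suc (Fin.suc Fin.zero)) = byKeys _≥₊_ _≤₊_ lo hi

  extension-total : ∀ i → IsTotalOrder (_≈ₚ_ Arc) (extension i)
  extension-total Fin.zero = byKeys-total ≤₊-total ≥₊-total hi lo ≈⇒spines′ spines⇒≈′
  extension-total (Fin.suc Fin.zero) = byKeys-total ≤₋-total ≥₊-total hi lo ≈⇒spines′ spines⇒≈′
  extension-total (Fin.suc (Fin.suc Fin.zero)) = byKeys-total ≥₊-total ≤₊-total lo hi ≈⇒spines spines⇒≈

  -- nested spines place P below Q in every extension (prefixes are lexicographically smaller)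
  spines⇒extensions : ∀ P Q → lo Q ≼ lo P → hi P ≼ hi Q → ∀ i → extension i P Q
  spines⇒extensions P Q lo≼ hi≼ Fin.zero =
    ×-Lex-intro _≋_ _≤₊_ _≥₊_ dec≋ (≼⇒lex _ hi≼) (λ _ → ≼⇒lex _ lo≼)
  spines⇒extensions P Q lo≼ hi≼ (Fin.suc Fin.zero) =
    ×-Lex-intro _≋_ _≤₋_ _≥₊_ dec≋ (≼⇒lex _ hi≼) (λ _ → ≼⇒lex _ lo≼)
  spines⇒extensions P Q lo≼ hi≼ (Fin.suc (Fin.suc Fin.zero)) =
    ×-Lex-intro _≋_ _≥₊_ _≤₊_ dec≋ (≼⇒lex _ lo≼) (λ _ → ≼⇒lex _ hi≼)

  -- the first two extensions nest the hi spines; the third then nests the lo spines,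
  -- which are both prefixes of hi Q
  extensions⇒spines : ∀ P Q → (∀ i → extension i P Q) → lo Q ≼ lo P × hi P ≼ hi Q
  extensions⇒spines P Q below = lo≼ , hi≼
    where
      hi≼ : hi P ≼ hi Q
      hi≼ = lex-both⇒≼ FinP.<-irrefl FinP.<-asym
              (×-Lex-fst _≋_ _≤₊_ _≥₊_ (IsTotalOrder.reflexive ≤₊-total) (below Fin.zero))
              (×-Lex-fst _≋_ _≤₋_ _≥₊_ (IsTotalOrder.reflexive ≤₋-total) (below (Fin.suc Fin.zero)))
      lo≼ : lo Q ≼ lo P
      lo≼ = lex-common⇒≼ FinP.<-irrefl FinP.<-asym
              (≼-trans (path-tail P , hi-lo P) hi≼) (path-tail Q , hi-lo Q)
              (×-Lex-fst _≋_ _≥₊_ _≤₊_ (IsTotalOrder.reflexive ≥₊-total) (below (Fin.suc (Fin.suc Fin.zero))))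

proposition1 : (n : ℕ) (Arc : Digraph n) → IsArborescence Arc → DimensionAtMost Arc 3
proposition1 n Arc ((noLoop , noDigon , noCycle) , r , reach) =
    extension , extension-total , λ P Q →
        (λ P⊆Q → let lo≼ , hi≼ = ⊆⇒spines P Q P⊆Q in spines⇒extensions P Q lo≼ hi≼)
      , (λ below → let lo≼ , hi≼ = extensions⇒spines P Q below in spines⇒⊆ P Q lo≼ hi≼)
  where open Arborescence Arc noLoop noDigon noCycle r reach
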